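{- Let $G=(V,E)$ be a graph and $\{C_1,\dots,C_k\}$ a generalized $k$-community structure of $G$. If $C_i=\{u\}$ for some $i\in\{1,\dots,k\}$ and $u\in V$, then for every neighbour $v$ of $u$, with $v\in C_j$ ($j\ne i$), we have $C_j\subseteq N[v]$.
   Context: $N[v]=N(v)\cup\{v\}$; $N_C(v)$ is the set of neighbours of $v$ in $C$. A generalized $k$-community structure of $G$ is a partition of $V$ into $k\ge 2$ nonempty sets $C_1,\dots,C_k$ such that for all $i$, every $v\in C_i$ and every $j\ne i$: $|N_{C_i}(v)|\cdot|C_j|\ge |N_{C_j}(v)|\cdot(|C_i|-1)$. -}

module Defs where

open import Data.Nat using (ℕ; _*_; _∸_; _≥_)
open import Data.Fin using (Fin)
open import Data.List using (length; filter; allFin)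
open import Data.Product using (_×_; Σ; _,_)
open import Relation.Nullary using (¬_; Dec)
open import Relation.Unary using (Decidable)
open import Relation.Binary.PropositionalEquality using (_≡_)
open import Data.Fin using (_≟_)
open import Relation.Nullary.Decidable using (_×-dec_)

record Graph (n : ℕ) : Set₁ where
  field
    Adj      : Fin n → Fin n → Set
    adj?     : (u v : Fin n) → Dec (Adj u v)
    sym      : ∀ {u v} → Adj u v → Adj v u
    irrefl   : ∀ {u} → ¬ Adj u u

open Graph public

count : {n : ℕ} {P : Fin n → Set} → Decidable P → ℕ
count {n} P? = length (filter P? (allFin n))

-- A partition of Fin n into k (labelled) parts: part v is the index of the
-- part containing v.  C_i = { v | part v ≡ i }.

partSize : {n k : ℕ} → (Fin n → Fin k) → Fin k → ℕ
partSize part i = count (λ w → part w ≟ i)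

nbrsIn : {n k : ℕ} → Graph n → (Fin n → Fin k) → Fin n → Fin k → ℕ
nbrsIn G part v i = count (λ w → adj? G v w ×-dec (part w ≟ i))

-- Generalized k-community structure: k ≥ 2, every part nonempty, and the
-- inequality |N_{C_i}(v)|·|C_j| ≥ |N_{C_j}(v)|·(|C_i| - 1).
-- (|C_i| ≥ 1 whenever v ∈ C_i, so truncated subtraction is exact.)
record IsGenCommunityStructure {n : ℕ} (G : Graph n) (k : ℕ)
                               (part : Fin n → Fin k) : Set where
  field
    k≥2      : k ≥ 2
    nonempty : (i : Fin k) → Σ (Fin n) (λ v → part v ≡ i)
    balance  : (i j : Fin k) (v : Fin n) → part v ≡ i → ¬ (j ≡ i) →
               nbrsIn G part v i * partSize part j
                 ≥ nbrsIn G part v j * (partSize part i ∸ 1)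

-- Since |C_i| = 1
-- and |N_{C_i}(v)| ≥ 1, the balance inequality for v and the pair (j, i) gives
-- |N_{C_j}(v)| ≥ |C_j| − 1.  A vertex w ∈ C_j outside N[v] would instead give
-- |N_{C_j}(v)| < |N[v] ∩ C_j| < |C_j|.
module Submission where

open import Defs
open import Data.Nat using (ℕ; _≤_; _<_; _*_; _∸_; z≤n; s≤s)
open import Data.Nat.Properties
  using (≤-refl; ≤-<-trans; ∸-monoˡ-≤; *-monoˡ-≤; *-monoʳ-≤; *-identityˡ; *-identityʳ; <⇒≱; m≤n⇒m≤1+n; module ≤-Reasoning)
open import Data.Fin using (Fin; _≟_)
open import Data.Sum using (_⊎_; inj₁; inj₂)
open import Data.Product using (_,_; proj₂)
open import Data.List using (_∷_; length; filter; allFin)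
open import Data.List.Properties using (filter-none; filter-some)
open import Data.List.Relation.Unary.All as All using ([]; _∷_)
open import Data.List.Relation.Unary.AllPairs using ([]; _∷_)
open import Data.List.Relation.Unary.Any using (here; there)
open import Data.List.Membership.Propositional using (_∈_; lose)
open import Data.List.Membership.Propositional.Properties using (∈-allFin)
open import Data.List.Relation.Binary.Sublist.Propositional using (⊆-refl)
open import Data.List.Relation.Binary.Sublist.Propositional.Properties using (length-mono-≤; filter⁺)
open import Data.List.Relation.Unary.Unique.Propositional using (Unique)
open import Data.List.Relation.Unary.Unique.Propositional.Properties using (allFin⁺)
open import Relation.Nullary using (¬_; yes; no; contradiction)
open import Relation.Nullary.Decidable using (_×-dec_; _⊎-dec_)
open import Relation.Unary using (Pred; Decidable; _⊆_)
open import Relation.Binary.PropositionalEquality using (_≡_; _≢_; refl; trans) renaming (sym to ≡-sym)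

module _ {a p q} {A : Set a} {P : Pred A p} {Q : Pred A q}
         (P? : Decidable P) (Q? : Decidable Q) (P⊆Q : P ⊆ Q) where

  length-filter-mono : ∀ xs → length (filter P? xs) ≤ length (filter Q? xs)
  length-filter-mono xs = length-mono-≤ (filter⁺ P? Q? (λ { refl → P⊆Q }) (⊆-refl {x = xs}))

  length-filter-mono-< : ∀ {y} xs → y ∈ xs → Q y → ¬ P y →
                         length (filter P? xs) < length (filter Q? xs)
  length-filter-mono-< (x ∷ xs) (here refl) Qy ¬Py with P? x | Q? x
  ... | yes Px | _     = contradiction Px ¬Py
  ... | no _   | yes _ = s≤s (length-filter-mono xs)
  ... | no _   | no ¬Qy = contradiction Qy ¬Qy
  length-filter-mono-< (x ∷ xs) (there y∈xs) Qy ¬Py with P? x | Q? x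
  ... | yes Px | no ¬Qx = contradiction (P⊆Q Px) ¬Qx
  ... | yes _  | yes _  = s≤s (length-filter-mono-< xs y∈xs Qy ¬Py)
  ... | no _   | yes _  = m≤n⇒m≤1+n (length-filter-mono-< xs y∈xs Qy ¬Py)
  ... | no _   | no _   = length-filter-mono-< xs y∈xs Qy ¬Py

length-filter-≤1 : ∀ {a p} {A : Set a} {P : Pred A p} (P? : Decidable P) →
                   (∀ {x y} → P x → P y → x ≡ y) →
                   ∀ {xs} → Unique xs → length (filter P? xs) ≤ 1
length-filter-≤1 P? P-unique [] = z≤n
length-filter-≤1 P? P-unique {x ∷ xs} (x∉xs ∷ xs-unique) with P? x
... | no _ = length-filter-≤1 P? P-unique xs-unique
... | yes Px rewrite filter-none P? (All.map (λ x≢y Py → x≢y (P-unique Px Py)) x∉xs) = ≤-refl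

module _ {n k : ℕ} (G : Graph n) (part : Fin n → Fin k) where

  closedNbrsIn : Fin n → Fin k → ℕ
  closedNbrsIn v j = count (λ w → (adj? G v w ⊎-dec (w ≟ v)) ×-dec (part w ≟ j))

  partSize-singleton : ∀ {i u} → (∀ w → part w ≡ i → w ≡ u) → partSize part i ≤ 1
  partSize-singleton {i} {u} C≡u =
    length-filter-≤1 (λ w → part w ≟ i) (λ {x} {y} px py → trans (C≡u x px) (≡-sym (C≡u y py)))
                     (allFin⁺ n)

  nbrsIn-pos : ∀ {v u i} → Adj G v u → part u ≡ i → 1 ≤ nbrsIn G part v i
  nbrsIn-pos {v} {u} {i} vu pu =
    filter-some (λ w → adj? G v w ×-dec (part w ≟ i)) (lose (∈-allFin u) (vu , pu))

  nbrsIn<closedNbrsIn : ∀ {v j} → part v ≡ j → nbrsIn G part v j < closedNbrsIn v j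
  nbrsIn<closedNbrsIn {v} {j} pv =
    length-filter-mono-< (λ w → adj? G v w ×-dec (part w ≟ j))
                         (λ w → (adj? G v w ⊎-dec (w ≟ v)) ×-dec (part w ≟ j))
                         (λ (vw , pw) → inj₁ vw , pw)
                         (allFin n) (∈-allFin v) (inj₂ refl , pv) (λ (vv , _) → irrefl G vv)

  closedNbrsIn<partSize : ∀ {v j w} → part w ≡ j → w ≢ v → ¬ Adj G v w →
                          closedNbrsIn v j < partSize part j
  closedNbrsIn<partSize {v} {j} {w} pw w≢v ¬vw =
    length-filter-mono-< (λ w → (adj? G v w ⊎-dec (w ≟ v)) ×-dec (part w ≟ j))
                         (λ w → part w ≟ j) proj₂
                         (allFin n) (∈-allFin w) pw
                         λ { (inj₁ vw , _) → ¬vw vw ; (inj₂ w≡v , _) → w≢v w≡v }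

  nbrsIn<partSize∸1 : ∀ {v j w} → part v ≡ j → part w ≡ j → w ≢ v → ¬ Adj G v w →
                      nbrsIn G part v j < partSize part j ∸ 1
  nbrsIn<partSize∸1 pv pw w≢v ¬vw =
    ∸-monoˡ-≤ 1 (≤-<-trans (nbrsIn<closedNbrsIn pv) (closedNbrsIn<partSize pw w≢v ¬vw))

  partSize∸1≤nbrsIn : IsGenCommunityStructure G k part →
                      ∀ {i u v j} → (∀ w → part w ≡ i → w ≡ u) → part u ≡ i →
                      Adj G v u → part v ≡ j → j ≢ i →
                      partSize part j ∸ 1 ≤ nbrsIn G part v j
  partSize∸1≤nbrsIn cs {i} {u} {v} {j} C≡u pu vu pv j≢i = begin
    Cj ∸ 1                 ≡⟨ ≡-sym (*-identityˡ (Cj ∸ 1)) ⟩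
    1 * (Cj ∸ 1)           ≤⟨ *-monoˡ-≤ (Cj ∸ 1) (nbrsIn-pos vu pu) ⟩
    nbrsIn G part v i * (Cj ∸ 1)
      ≤⟨ IsGenCommunityStructure.balance cs j i v pv (λ i≡j → j≢i (≡-sym i≡j)) ⟩
    nbrsIn G part v j * partSize part i
      ≤⟨ *-monoʳ-≤ (nbrsIn G part v j) (partSize-singleton C≡u) ⟩
    nbrsIn G part v j * 1  ≡⟨ *-identityʳ _ ⟩
    nbrsIn G part v j      ∎
    where
    open ≤-Reasoning
    Cj : ℕ
    Cj = partSize part j

corollary1 : {n k : ℕ} (G : Graph n) (part : Fin n → Fin k) →
             IsGenCommunityStructure G k part →
             (i : Fin k) (u : Fin n) →
             ((w : Fin n) → part w ≡ i → w ≡ u) → part u ≡ i →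
             (v : Fin n) → Adj G u v →
             (j : Fin k) → part v ≡ j → ¬ (j ≡ i) →
             (w : Fin n) → part w ≡ j → w ≡ v ⊎ Adj G v w
corollary1 G part cs i u C≡u pu v uv j pv j≢i w pw with w ≟ v | adj? G v w
... | yes w≡v | _      = inj₁ w≡v
... | no _    | yes vw = inj₂ vw
... | no w≢v  | no ¬vw =
  contradiction (partSize∸1≤nbrsIn G part cs C≡u pu (Graph.sym G uv) pv j≢i)
                (<⇒≱ (nbrsIn<partSize∸1 G part pv pw w≢v ¬vw))
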